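{- (a) For all distinct $i,j\in\{1,2,3,4\}$, $M_4[i,j] = -M_4^*[i,\sigma_{4,i}(j)] = -M_4^*[\sigma_{4,j}(i),j]$. (b) For all $p=2^n\ge 8$ and all distinct $i,j\in\{1,\dots,p\}$, $M_p[i,j] = \pm M_p^*[i,\sigma_{p,i}(j)] = \pm M_p^*[\sigma_{p,j}(i),j]$, where the sign is $+$ except when $|j-i| = p/2$, in which case it is $-$.
   Context: Throughout, $p = 2^n$ with $n \ge 2$. The $4\times 4$ matrices $M_4$ and $M_4^*$ are, row by row, $M_4$: $(0,1,2,3)$, $(-1,0,3,-2)$, $(-2,-3,0,1)$, $(-3,2,-1,0)$; $M_4^*$: $(0,-2,-3,-1)$, $(2,0,1,-3)$, $(3,-1,0,2)$, $(1,3,-2,0)$. For $p = 2^n \ge 8$, $M_p$ and $M_p^*$ are $p\times p$ matrices consisting of a $(p/4)\times(p/4)$ array of $4\times 4$ blocks; with $I$ the $4\times 4$ identity and $1\le a,b\le p/4$ block indices, block $(a,b)$ of $M_p$ is: $M_4$ if $b-a=0$; $-M_4+4I$ if $b-a\equiv 1 \pmod 4$; $-M_4-4I$ if $b-a\equiv -1\pmod 4$; $M_4+(x+4)I$ if $b-a = y\cdot 2^x$ with $x\ge 1$ and $y\equiv 1\pmod 4$; $M_4-(x+4)I$ if $b-a=y\cdot 2^x$ with $x\ge1$ and $y\equiv -1\pmod 4$. Block $(a,b)$ of $M_p^*$ is: $M_4^*$ if $b-a=0$; $-M_4^*-4I$ if $b-a\equiv 1\pmod 4$; $-M_4^*+4I$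 if $b-a\equiv -1\pmod 4$; $M_4^*-(x+4)I$ if $b-a=y\cdot 2^x$ with $x\ge1$, $y\equiv 1\pmod 4$; $M_4^*+(x+4)I$ if $b-a=y\cdot 2^x$ with $x\ge 1$, $y\equiv -1\pmod 4$. For each $k\in\{1,\dots,p\}$, $\sigma_{p,k}$ is a map from $\{1,\dots,p\}\setminus\{k\}$ to itself, defined inductively. For $p=4$: $\sigma_{4,1}: 2\mapsto 4, 3\mapsto 2, 4\mapsto 3$; $\sigma_{4,2}: 1\mapsto 3, 3\mapsto 4, 4\mapsto 1$; $\sigma_{4,3}: 1\mapsto 4, 2\mapsto 1, 4\mapsto 2$; $\sigma_{4,4}: 1\mapsto 2, 2\mapsto 3, 3\mapsto 1$. For $p\ge 8$ and $i\ne k$: if $k\le p/2$, then $\sigma_{p,k}(i)=\sigma_{p/2,k}(i)+p/2$ for $i\le p/2$; $\sigma_{p,k}(i)=\sigma_{p/2,k}(i-p/2)$ for $i>p/2$, $i\ne k+p/2$; and $\sigma_{p,k}(k+p/2)=k+p/2$. If $k>p/2$, then $\sigma_{p,k}(i)=\sigma_{p/2,k-p/2}(i)+p/2$ for $i\le p/2$, $i\ne k-p/2$; $\sigma_{p,k}(i)=\sigma_{p/2,k-p/2}(i-p/2)$ for $i>p/2$; and $\sigma_{p,k}(k-p/2)=k-p/2$. -}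

module Defs where

open import Data.Nat as ℕ using (ℕ; zero; suc; _∸_; _^_; _≤?_; _≟_; _/_; _%_)
open import Data.Integer as ℤ using (ℤ; +_; -_; ∣_∣; sign; _◃_)
open import Data.Integer.DivMod using (_%ℕ_)
open import Data.Bool using (Bool; true; false; if_then_else_)
open import Data.Product using (_×_; _,_)
open import Relation.Nullary.Decidable using (⌊_⌋)

-- All matrix / permutation indices are 1-based natural numbers, as in
-- the paper.  Outside the meaningful range the functions return junk.

M4 : ℕ → ℕ → ℤ
M4 1 1 = + 0
M4 1 2 = + 1
M4 1 3 = + 2
M4 1 4 = + 3
M4 2 1 = - (+ 1)
M4 2 2 = + 0
M4 2 3 = + 3
M4 2 4 = - (+ 2)
M4 3 1 = - (+ 2)
M4 3 2 = - (+ 3)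
M4 3 3 = + 0
M4 3 4 = + 1
M4 4 1 = - (+ 3)
M4 4 2 = + 2
M4 4 3 = - (+ 1)
M4 4 4 = + 0
M4 _ _ = + 0

M4* : ℕ → ℕ → ℤ
M4* 1 1 = + 0
M4* 1 2 = - (+ 2)
M4* 1 3 = - (+ 3)
M4* 1 4 = - (+ 1)
M4* 2 1 = + 2
M4* 2 2 = + 0
M4* 2 3 = + 1
M4* 2 4 = - (+ 3)
M4* 3 1 = + 3
M4* 3 2 = - (+ 1)
M4* 3 3 = + 0
M4* 3 4 = + 2
M4* 4 1 = + 1
M4* 4 2 = + 3
M4* 4 3 = - (+ 2)
M4* 4 4 = + 0
M4* _ _ = + 0

I4 : ℕ → ℕ → ℤ
I4 r c = if ⌊ r ≟ c ⌋ then + 1 else + 0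

-- 2-adic decomposition: for m > 0, split2 m = (x , y′) with
-- m = y′ · 2^x and y′ odd.  (First argument is fuel; fuel = m suffices.)

split2-fuel : ℕ → ℕ → ℕ × ℕ
split2-fuel zero    m = 0 , m
split2-fuel (suc f) zero = 0 , 0
split2-fuel (suc f) (suc m) with (suc m) % 2
... | zero  with split2-fuel f ((suc m) / 2)
...   | x , y = suc x , y
split2-fuel (suc f) (suc m) | suc _ = 0 , suc m

split2 : ℕ → ℕ × ℕ
split2 m = split2-fuel m m

-- The type of block (a,b) is determined by the integer d = b - a.
data BlockKind : Set where
  diag      : BlockKind            -- d = 0
  odd+1     : BlockKind            -- d ≡ 1  (mod 4)
  odd-1     : BlockKind            -- d ≡ -1 (mod 4)
  pow+      : ℕ → BlockKind        -- d = y·2^x, x ≥ 1, y ≡ 1  (mod 4)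
  pow-      : ℕ → BlockKind        -- d = y·2^x, x ≥ 1, y ≡ -1 (mod 4)

blockKind : ℤ → BlockKind
blockKind d with ∣ d ∣
... | zero = diag
... | suc k with d %ℕ 4
...   | 1 = odd+1
...   | 3 = odd-1
...   | _ with split2 (suc k)
...     | x , y′ = if ⌊ ((sign d ◃ y′) %ℕ 4) ≟ 1 ⌋ then pow+ x else pow- x

blockM : BlockKind → ℕ → ℕ → ℤ
blockM diag      r c = M4 r c
blockM odd+1     r c = ℤ.- M4 r c ℤ.+ (+ 4) ℤ.* I4 r c
blockM odd-1     r c = ℤ.- M4 r c ℤ.- (+ 4) ℤ.* I4 r c
blockM (pow+ x)  r c = M4 r c ℤ.+ (+ (x ℕ.+ 4)) ℤ.* I4 r c
blockM (pow- x)  r c = M4 r c ℤ.- (+ (x ℕ.+ 4)) ℤ.* I4 r c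

blockM* : BlockKind → ℕ → ℕ → ℤ
blockM* diag      r c = M4* r c
blockM* odd+1     r c = ℤ.- M4* r c ℤ.- (+ 4) ℤ.* I4 r c
blockM* odd-1     r c = ℤ.- M4* r c ℤ.+ (+ 4) ℤ.* I4 r c
blockM* (pow+ x)  r c = M4* r c ℤ.- (+ (x ℕ.+ 4)) ℤ.* I4 r c
blockM* (pow- x)  r c = M4* r c ℤ.+ (+ (x ℕ.+ 4)) ℤ.* I4 r c

blk : ℕ → ℕ
blk i = (i ∸ 1) / 4 ℕ.+ 1

pos : ℕ → ℕ
pos i = (i ∸ 1) % 4 ℕ.+ 1

-- Entry [i,j] of M_p and M_p*, p = 2^n (for 1 ≤ i,j ≤ p).
-- (The entry formula does not actually depend on p.)
Mp : (n : ℕ) → ℕ → ℕ → ℤ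
Mp n i j = blockM (blockKind (+ blk j ℤ.- + blk i)) (pos i) (pos j)

Mp* : (n : ℕ) → ℕ → ℕ → ℤ
Mp* n i j = blockM* (blockKind (+ blk j ℤ.- + blk i)) (pos i) (pos j)

-- σ_{p,k}(i) with p = 2^n, written sigma n k i (n ≥ 2, i ≠ k).

sigma4 : ℕ → ℕ → ℕ
sigma4 1 2 = 4
sigma4 1 3 = 2
sigma4 1 4 = 3
sigma4 2 1 = 3
sigma4 2 3 = 4
sigma4 2 4 = 1
sigma4 3 1 = 4
sigma4 3 2 = 1
sigma4 3 4 = 2
sigma4 4 1 = 2
sigma4 4 2 = 3
sigma4 4 3 = 1
sigma4 _ _ = 0

sigma : ℕ → ℕ → ℕ → ℕ
sigma 0 k i = 0
sigma 1 k i = 0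
sigma 2 k i = sigma4 k i
sigma (suc (suc (suc m))) k i =
  let n′ = suc (suc m)
      h  = 2 ^ n′
  in if ⌊ k ≤? h ⌋
     then (if ⌊ i ≤? h ⌋
           then sigma n′ k i ℕ.+ h
           else (if ⌊ i ≟ k ℕ.+ h ⌋ then k ℕ.+ h else sigma n′ k (i ∸ h)))
     else (if ⌊ i ≤? h ⌋
           then (if ⌊ i ≟ k ∸ h ⌋ then k ∸ h else sigma n′ (k ∸ h) i ℕ.+ h)
           else sigma n′ (k ∸ h) (i ∸ h))

-- Write an index as a block index blk and an offset pos ∈ {1,…,4}.  A block of M_p (resp. M_p*)
-- is κ·M₄ + c·I (resp. κ·M₄* − c·I) with κ = −1 exactly when the block difference is odd.
-- Induction on p describes s = σ_{p,k}(i).  If i and k have different offsets, s has offset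
-- σ₄(pos k, pos i) and block index p/4 + 1 − blk i; the two block differences in the claim then
-- have odd sum, so their κ differ, and this sign is undone by M₄[r,c] = −M₄*[r,σ₄(r,c)] =
-- −M₄*[σ₄(c,r),c].  If the offsets agree, both entries lie on block diagonals, where only c
-- matters: either |i − k| = p/2, s = i and the diagonal entries of M_p and M_p* are opposite,
-- or the two block differences are 2^v·u and 2^v·u′ with u ≡ −u′ ≡ ±1 (mod 4); then their
-- block kinds are opposite, which makes the diagonal entries c of M_p and −c′ of M_p* agree.

module Submission where

open import Defs
open import Data.Nat using (ℕ; _≤_; _^_; _∸_; ∣_-_∣)
open import Data.Integer using (ℤ; +_; -_; _*_)
open import Data.Product using (_×_)
open import Relation.Binary.PropositionalEquality using (_≡_; _≢_)
open import Data.Bool using (if_then_else_)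
open import Relation.Nullary.Decidable using (⌊_⌋)
open import Data.Nat.Properties using (_≟_)

open import Data.Nat as ℕ using (zero; suc; z≤n; s≤s; _<_)
import Data.Nat.Properties as ℕ
import Data.Nat.DivMod as ℕ
import Data.Nat.Tactic.RingSolver as ℕ-Ring
open import Data.Nat.Divisibility using (divides-refl)
open import Data.Integer as ℤ using (_+_; _-_; _⊖_; sign; _◃_)
import Data.Integer.Properties as ℤ
open import Data.Integer.DivMod using (_%ℕ_; _/ℕ_; a≡a%ℕn+[a/ℕn]*n; n%ℕd<d)
open import Data.Integer.Tactic.RingSolver using (solve-∀)
open import Data.Sign as Sign using (Sign)
open import Data.Product using (∃; _,_; map; map₁; proj₁; proj₂)
open import Function using (_∘_)
open import Data.Bool using (true; false)
open import Data.Sum using (_⊎_; inj₁; inj₂; [_,_]; swap)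
open import Data.Empty using (⊥-elim)
open import Relation.Nullary using (Dec; yes; no; ¬_; contradiction)
open import Relation.Binary.PropositionalEquality
  using (refl; sym; trans; cong; cong₂; subst; subst₂; module ≡-Reasoning)

-- Residues modulo 4

%ℕ-unique : ∀ z {d} .{{_ : ℕ.NonZero d}} r (q : ℤ) → r < d → z ≡ + r + q * + d → z %ℕ d ≡ r
%ℕ-unique z {d} r q r<d z≡r+qd =
  ℤ.+-injective (ℤ.i-j≡0⇒i≡j (+ r′) (+ r) (trans (ℤ.m-n≡m⊖n r′ r) (trans difference q-q′*d≡0)))
  where
  r′ : ℕ
  r′ = z %ℕ d
  q′ : ℤ
  q′ = z /ℕ d
  difference : r′ ⊖ r ≡ (q - q′) * + d
  difference = begin
    r′ ⊖ r                                 ≡⟨ ℤ.m-n≡m⊖n r′ r ⟨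
    + r′ - + r                             ≡⟨ ring (+ r′) (+ r) q q′ (+ d) ⟩
    (+ r′ + q′ * + d) - (+ r + q * + d) + (q - q′) * + d
      ≡⟨ cong₂ (λ a b → a - b + (q - q′) * + d) (a≡a%ℕn+[a/ℕn]*n z d) z≡r+qd ⟨
    z - z + (q - q′) * + d                 ≡⟨ cancel z ((q - q′) * + d) ⟩
    (q - q′) * + d                         ∎
    where
    open ≡-Reasoning
    ring : ∀ a b c c′ d → a - b ≡ (a + c′ * d) - (b + c * d) + (c - c′) * d
    ring = solve-∀
    cancel : ∀ x y → x - x + y ≡ y
    cancel = solve-∀
  ∣r′-r∣<d : ℤ.∣ r′ ⊖ r ∣ < d
  ∣r′-r∣<d = ℕ.≤-<-trans (ℤ.∣m⊝n∣≤m⊔n r′ r) (ℕ.⊔-lub (n%ℕd<d z d) r<d)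
  ∣q-q′∣≡0 : ℤ.∣ q - q′ ∣ ≡ 0
  ∣q-q′∣≡0 with ℤ.∣ q - q′ ∣ in eq
  ... | zero = refl
  ... | suc c = ⊥-elim (ℕ.<⇒≱ ∣r′-r∣<d (begin
    d                     ≤⟨ ℕ.m≤n*m d (suc c) ⟩
    suc c ℕ.* d           ≡⟨ cong (ℕ._* d) eq ⟨
    ℤ.∣ q - q′ ∣ ℕ.* d    ≡⟨ ℤ.abs-* (q - q′) (+ d) ⟨
    ℤ.∣ (q - q′) * + d ∣  ≡⟨ cong ℤ.∣_∣ difference ⟨
    ℤ.∣ r′ ⊖ r ∣          ∎))
    where open ℕ.≤-Reasoning
  q-q′*d≡0 : (q - q′) * + d ≡ + 0
  q-q′*d≡0 = cong (_* + d) (ℤ.∣i∣≡0⇒i≡0 {q - q′} ∣q-q′∣≡0)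

even⊎odd : ∀ z → (∃ λ y → z ≡ + 2 * y) ⊎ (∃ λ y → z ≡ + 1 + + 2 * y)
even⊎odd z with z %ℕ 2 | n%ℕd<d z 2 | a≡a%ℕn+[a/ℕn]*n z 2
... | 0 | _ | z≡ = inj₁ (z /ℕ 2 , trans z≡ (ring (z /ℕ 2)))
  where
  ring : ∀ q → + 0 + q * + 2 ≡ + 2 * q
  ring = solve-∀
... | 1 | _ | z≡ = inj₂ (z /ℕ 2 , trans z≡ (ring (z /ℕ 2)))
  where
  ring : ∀ q → + 1 + q * + 2 ≡ + 1 + + 2 * q
  ring = solve-∀
... | suc (suc _) | s≤s (s≤s ()) | _

[t+2y]%ℕ4 : ∀ t y → t < 2 → (+ t + + 2 * y) %ℕ 4 ≡ t ℕ.+ 2 ℕ.* (y %ℕ 2)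
[t+2y]%ℕ4 t y t<2 = %ℕ-unique _ (t ℕ.+ 2 ℕ.* r) (y /ℕ 2) bound (begin
  + t + + 2 * y                       ≡⟨ cong (λ y → + t + + 2 * y) (a≡a%ℕn+[a/ℕn]*n y 2) ⟩
  + t + + 2 * (+ r + y /ℕ 2 * + 2)    ≡⟨ ring (+ t) (+ r) (y /ℕ 2) ⟩
  (+ t + + 2 * + r) + y /ℕ 2 * + 4    ≡⟨ cong (λ a → (+ t + a) + y /ℕ 2 * + 4) (ℤ.pos-* 2 r) ⟨
  (+ t + + (2 ℕ.* r)) + y /ℕ 2 * + 4  ≡⟨ cong (_+ y /ℕ 2 * + 4) (ℤ.pos-+ t (2 ℕ.* r)) ⟨
  + (t ℕ.+ 2 ℕ.* r) + y /ℕ 2 * + 4    ∎)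
  where
  open ≡-Reasoning
  r : ℕ
  r = y %ℕ 2
  bound : t ℕ.+ 2 ℕ.* r < 4
  bound = s≤s (ℕ.+-mono-≤ (ℕ.s≤s⁻¹ t<2) (ℕ.*-monoʳ-≤ 2 (ℕ.s≤s⁻¹ (n%ℕd<d y 2))))
  ring : ∀ t r q → t + + 2 * (r + q * + 2) ≡ (t + + 2 * r) + q * + 4
  ring = solve-∀

even-%ℕ4 : ∀ y → (+ 2 * y) %ℕ 4 ≡ 0 ⊎ (+ 2 * y) %ℕ 4 ≡ 2
even-%ℕ4 y with y %ℕ 2 | n%ℕd<d y 2 | [t+2y]%ℕ4 0 y (s≤s z≤n)
... | 0 | _ | res = inj₁ (trans (cong (_%ℕ 4) (sym (ℤ.+-identityˡ (+ 2 * y)))) res)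
... | 1 | _ | res = inj₂ (trans (cong (_%ℕ 4) (sym (ℤ.+-identityˡ (+ 2 * y)))) res)
... | suc (suc _) | s≤s (s≤s ()) | _

odd-%ℕ4 : ∀ y → (+ 1 + + 2 * y) %ℕ 4 ≡ 1 ⊎ (+ 1 + + 2 * y) %ℕ 4 ≡ 3
odd-%ℕ4 y with y %ℕ 2 | n%ℕd<d y 2 | [t+2y]%ℕ4 1 y (s≤s (s≤s z≤n))
... | 0 | _ | res = inj₁ res
... | 1 | _ | res = inj₂ res
... | suc (suc _) | s≤s (s≤s ()) | _

residue : Sign → ℕ
residue Sign.+ = 1
residue Sign.- = 3

[±1+4w]%ℕ4 : ∀ s w → ((s ◃ 1) + w * + 4) %ℕ 4 ≡ residue s
[±1+4w]%ℕ4 Sign.+ w = %ℕ-unique _ 1 w (s≤s (s≤s z≤n)) refl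
[±1+4w]%ℕ4 Sign.- w = %ℕ-unique _ 3 (w - + 1) (s≤s (s≤s (s≤s (s≤s z≤n)))) (ring w)
  where
  ring : ∀ w → - + 1 + w * + 4 ≡ + 3 + (w - + 1) * + 4
  ring = solve-∀

∣±1+4w∣%2≡1 : ∀ s w → ℤ.∣ (s ◃ 1) + w * + 4 ∣ ℕ.% 2 ≡ 1
∣±1+4w∣%2≡1 s w = odd-abs ((s ◃ 1) + w * + 4) (odd s)
  where
  odd : ∀ s → ((s ◃ 1) + w * + 4) %ℕ 2 ≡ 1
  odd Sign.+ = %ℕ-unique _ 1 (w * + 2) (s≤s (s≤s z≤n)) (ring w)
    where
    ring : ∀ w → + 1 + w * + 4 ≡ + 1 + w * + 2 * + 2
    ring = solve-∀
  odd Sign.- = %ℕ-unique _ 1 (w * + 2 - + 1) (s≤s (s≤s z≤n)) (ring w)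
    where
    ring : ∀ w → - + 1 + w * + 4 ≡ + 1 + (w * + 2 - + 1) * + 2
    ring = solve-∀
  odd-abs : ∀ u → u %ℕ 2 ≡ 1 → ℤ.∣ u ∣ ℕ.% 2 ≡ 1
  odd-abs (+ n) u%2≡1 = u%2≡1
  odd-abs ℤ.-[1+ n ] u%2≡1 with suc n ℕ.% 2 | ℕ.m%n<n (suc n) 2
  ... | 0 | _ = u%2≡1
  ... | 1 | _ = refl
  ... | suc (suc _) | s≤s (s≤s ())

-- The 2-adic splitting

n<2^n : ∀ n → n < 2 ^ n
n<2^n zero    = s≤s z≤n
n<2^n (suc n) = begin-strict
  suc n               ≡⟨ ℕ.+-comm 1 n ⟩
  n ℕ.+ 1             <⟨ ℕ.+-mono-<-≤ (n<2^n n) (ℕ.m^n>0 2 n) ⟩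
  2 ^ n ℕ.+ 2 ^ n     ≡⟨ cong (2 ^ n ℕ.+_) (ℕ.+-identityʳ (2 ^ n)) ⟨
  2 ^ suc n           ∎
  where open ℕ.≤-Reasoning

split2-fuel-even : ∀ f m → suc m ℕ.% 2 ≡ 0 →
  split2-fuel (suc f) (suc m) ≡ map₁ suc (split2-fuel f (suc m ℕ./ 2))
split2-fuel-even f m even rewrite even = refl

split2-fuel-2^x* : ∀ x f m → m ℕ.% 2 ≡ 1 → x ≤ f → split2-fuel f (2 ^ x ℕ.* m) ≡ (x , m)
split2-fuel-2^x* zero zero m _ _ = cong (0 ,_) (ℕ.*-identityˡ m)
split2-fuel-2^x* zero (suc f) (suc m) odd _ rewrite ℕ.+-identityʳ m | odd = refl
split2-fuel-2^x* (suc x) (suc f) (suc m) odd (s≤s x≤f)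
  with 2 ^ x ℕ.* suc m in 2^x*m≡ | split2-fuel-2^x* x f (suc m) odd x≤f
... | zero  | _  = ⊥-elim (ℕ.<⇒≢ (ℕ.m^n>0 2 x) (sym (ℕ.m*n≡0⇒m≡0 (2 ^ x) (suc m) 2^x*m≡)))
... | suc a | ih = begin
  split2-fuel (suc f) (2 ^ suc x ℕ.* suc m)     ≡⟨ cong (split2-fuel (suc f)) 2^[1+x]*m≡ ⟩
  split2-fuel (suc f) (suc a ℕ.* 2)             ≡⟨ split2-fuel-even f _ (ℕ.m*n%n≡0 (suc a) 2) ⟩
  map₁ suc (split2-fuel f (suc a ℕ.* 2 ℕ./ 2))  ≡⟨ cong (map₁ suc ∘ split2-fuel f) (ℕ.m*n/n≡m (suc a) 2) ⟩
  map₁ suc (split2-fuel f (suc a))              ≡⟨ cong (map₁ suc) ih ⟩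
  (suc x , suc m)                               ∎
  where
  open ≡-Reasoning
  2^[1+x]*m≡ : 2 ^ suc x ℕ.* suc m ≡ suc a ℕ.* 2
  2^[1+x]*m≡ = trans (ℕ.*-assoc 2 (2 ^ x) (suc m)) (trans (cong (2 ℕ.*_) 2^x*m≡) (ℕ.*-comm 2 (suc a)))

-- Block kinds

kindSign : BlockKind → ℤ
kindSign diag     = + 1
kindSign odd+1    = - + 1
kindSign odd-1    = - + 1
kindSign (pow+ _) = + 1
kindSign (pow- _) = + 1

opposite : BlockKind → BlockKind
opposite diag     = diag
opposite odd+1    = odd-1
opposite odd-1    = odd+1
opposite (pow+ x) = pow- x
opposite (pow- x) = pow+ x

dyadicKind : ℕ → Sign → BlockKind
dyadicKind zero    Sign.+ = odd+1
dyadicKind zero    Sign.- = odd-1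
dyadicKind (suc x) Sign.+ = pow+ (suc x)
dyadicKind (suc x) Sign.- = pow- (suc x)

opposite-dyadicKind : ∀ v s → opposite (dyadicKind v s) ≡ dyadicKind v (Sign.opposite s)
opposite-dyadicKind zero    Sign.+ = refl
opposite-dyadicKind zero    Sign.- = refl
opposite-dyadicKind (suc x) Sign.+ = refl
opposite-dyadicKind (suc x) Sign.- = refl

powKind : Sign → ℕ × ℕ → BlockKind
powKind s (x , y) = if ⌊ (s ◃ y) %ℕ 4 ≟ 1 ⌋ then pow+ x else pow- x

%ℕ4≡suc⇒∣z∣≢0 : ∀ z {r} → z %ℕ 4 ≡ suc r → ℤ.∣ z ∣ ≢ 0
%ℕ4≡suc⇒∣z∣≢0 z z%4≡ ∣z∣≡0 with trans (cong (_%ℕ 4) (sym (ℤ.∣i∣≡0⇒i≡0 {z} ∣z∣≡0))) z%4≡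
... | ()

blockKind-%ℕ4≡1 : ∀ z → z %ℕ 4 ≡ 1 → blockKind z ≡ odd+1
blockKind-%ℕ4≡1 z z%4≡1 with ℤ.∣ z ∣ in ∣z∣≡
... | zero  = ⊥-elim (%ℕ4≡suc⇒∣z∣≢0 z z%4≡1 ∣z∣≡)
... | suc _ rewrite z%4≡1 = refl

blockKind-%ℕ4≡3 : ∀ z → z %ℕ 4 ≡ 3 → blockKind z ≡ odd-1
blockKind-%ℕ4≡3 z z%4≡3 with ℤ.∣ z ∣ in ∣z∣≡
... | zero  = ⊥-elim (%ℕ4≡suc⇒∣z∣≢0 z z%4≡3 ∣z∣≡)
... | suc _ rewrite z%4≡3 = refl

blockKind-even : ∀ z {k} → ℤ.∣ z ∣ ≡ suc k → z %ℕ 4 ≡ 0 ⊎ z %ℕ 4 ≡ 2 →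
                 blockKind z ≡ powKind (sign z) (split2 (suc k))
blockKind-even z ∣z∣≡ (inj₁ z%4≡0) rewrite ∣z∣≡ | z%4≡0 = refl
blockKind-even z ∣z∣≡ (inj₂ z%4≡2) rewrite ∣z∣≡ | z%4≡2 = refl

kindSign-1+2y : ∀ y → kindSign (blockKind (+ 1 + + 2 * y)) ≡ - + 1
kindSign-1+2y y with odd-%ℕ4 y
... | inj₁ z%4≡1 = cong kindSign (blockKind-%ℕ4≡1 (+ 1 + + 2 * y) z%4≡1)
... | inj₂ z%4≡3 = cong kindSign (blockKind-%ℕ4≡3 (+ 1 + + 2 * y) z%4≡3)

kindSign-evenResidue : ∀ z → z %ℕ 4 ≡ 0 ⊎ z %ℕ 4 ≡ 2 → kindSign (blockKind z) ≡ + 1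
kindSign-evenResidue z z%4 = by-∣z∣ ℤ.∣ z ∣ refl
  where
  kindSign-powKind : ∀ s p → kindSign (powKind s p) ≡ + 1
  kindSign-powKind s (x , y) with ⌊ (s ◃ y) %ℕ 4 ≟ 1 ⌋
  ... | true  = refl
  ... | false = refl
  by-∣z∣ : ∀ a → ℤ.∣ z ∣ ≡ a → kindSign (blockKind z) ≡ + 1
  by-∣z∣ zero    ∣z∣≡0 = cong (kindSign ∘ blockKind) (ℤ.∣i∣≡0⇒i≡0 {z} ∣z∣≡0)
  by-∣z∣ (suc k) ∣z∣≡  =
    trans (cong kindSign (blockKind-even z ∣z∣≡ z%4)) (kindSign-powKind (sign z) (split2 (suc k)))

kindSign-2y : ∀ y → kindSign (blockKind (+ 2 * y)) ≡ + 1
kindSign-2y y = kindSign-evenResidue (+ 2 * y) (even-%ℕ4 y)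

dyadic : ℕ → Sign → ℤ → ℤ
dyadic v s w = + (2 ^ v) * ((s ◃ 1) + w * + 4)

blockKind-dyadic : ∀ v s w → blockKind (dyadic v s w) ≡ dyadicKind v s
blockKind-dyadic zero s w = trans (cong blockKind (ℤ.*-identityˡ u)) (by-residue s ([±1+4w]%ℕ4 s w))
  where
  u : ℤ
  u = (s ◃ 1) + w * + 4
  by-residue : ∀ s → u %ℕ 4 ≡ residue s → blockKind u ≡ dyadicKind 0 s
  by-residue Sign.+ u%4 = blockKind-%ℕ4≡1 u u%4
  by-residue Sign.- u%4 = blockKind-%ℕ4≡3 u u%4
blockKind-dyadic (suc x) s w = by-∣z∣ (2 ^ suc x ℕ.* ℤ.∣ u ∣) refl
  where
  u : ℤ
  u = (s ◃ 1) + w * + 4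
  z : ℤ
  z = dyadic (suc x) s w
  z-even : z %ℕ 4 ≡ 0 ⊎ z %ℕ 4 ≡ 2
  z-even = subst (λ t → t %ℕ 4 ≡ 0 ⊎ t %ℕ 4 ≡ 2)
             (trans (sym (ℤ.*-assoc (+ 2) (+ (2 ^ x)) u)) (cong (_* u) (sym (ℤ.pos-* 2 (2 ^ x)))))
             (even-%ℕ4 (+ (2 ^ x) * u))
  powKind-residue : ∀ s → u %ℕ 4 ≡ residue s → powKind (sign u) (suc x , ℤ.∣ u ∣) ≡ dyadicKind (suc x) s
  powKind-residue Sign.+ u%4 rewrite ℤ.◃-inverse u | u%4 = refl
  powKind-residue Sign.- u%4 rewrite ℤ.◃-inverse u | u%4 = refl
  instance
    ∣u∣-nonZero : ℕ.NonZero ℤ.∣ u ∣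
    ∣u∣-nonZero =
      ℕ.≢-nonZero λ ∣u∣≡0 → ℕ.0≢1+n (trans (cong (ℕ._% 2) (sym ∣u∣≡0)) (∣±1+4w∣%2≡1 s w))
    2^[1+x]-nonZero : ℕ.NonZero (2 ^ suc x)
    2^[1+x]-nonZero = ℕ.m^n≢0 2 (suc x)
  by-∣z∣ : ∀ a → 2 ^ suc x ℕ.* ℤ.∣ u ∣ ≡ a → blockKind z ≡ dyadicKind (suc x) s
  by-∣z∣ zero    ∣z∣≡0 = ⊥-elim (ℕ.≢-nonZero⁻¹ _ {{ℕ.m*n≢0 (2 ^ suc x) ℤ.∣ u ∣}} ∣z∣≡0)
  by-∣z∣ (suc k) ∣z∣≡  = begin
    blockKind z                         ≡⟨ blockKind-even z (trans (ℤ.abs-* (+ (2 ^ suc x)) u) ∣z∣≡) z-even ⟩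
    powKind (sign z) (split2 (suc k))   ≡⟨ cong₂ powKind sign-z split2-z ⟩
    powKind (sign u) (suc x , ℤ.∣ u ∣)  ≡⟨ powKind-residue s ([±1+4w]%ℕ4 s w) ⟩
    dyadicKind (suc x) s                ∎
    where
    open ≡-Reasoning
    sign-z : sign z ≡ sign u
    sign-z = trans (cong (sign ∘ (sign u ◃_)) ∣z∣≡) (ℤ.sign-◃ (sign u) (suc k))
    split2-z : split2 (suc k) ≡ (suc x , ℤ.∣ u ∣)
    split2-z = subst (λ t → split2-fuel t t ≡ (suc x , ℤ.∣ u ∣)) ∣z∣≡
      (split2-fuel-2^x* (suc x) (2 ^ suc x ℕ.* ℤ.∣ u ∣) ℤ.∣ u ∣ (∣±1+4w∣%2≡1 s w)
        (ℕ.≤-trans (ℕ.<⇒≤ (n<2^n (suc x))) (ℕ.m≤m*n (2 ^ suc x) ℤ.∣ u ∣)))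

OppositeSigns : ℤ → ℤ → Set
OppositeSigns a b = (a ≡ + 1 × b ≡ - + 1) ⊎ (a ≡ - + 1 × b ≡ + 1)

OppositeSigns-flip : ∀ {a b} x → OppositeSigns a b → a * - x ≡ b * x
OppositeSigns-flip x (inj₁ (refl , refl)) = ring x
  where
  ring : ∀ x → + 1 * - x ≡ - + 1 * x
  ring = solve-∀
OppositeSigns-flip x (inj₂ (refl , refl)) = ring x
  where
  ring : ∀ x → - + 1 * - x ≡ + 1 * x
  ring = solve-∀

kindSign-complement : ∀ e c → OppositeSigns (kindSign (blockKind e)) (kindSign (blockKind (+ 1 + + 2 * c - e)))
kindSign-complement e c with even⊎odd e
... | inj₁ (y , refl) = inj₁ (kindSign-2y y ,
        subst (λ z → kindSign (blockKind z) ≡ - + 1) (sym (ring c y)) (kindSign-1+2y (c - y)))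
  where
  ring : ∀ c y → + 1 + + 2 * c - + 2 * y ≡ + 1 + + 2 * (c - y)
  ring = solve-∀
... | inj₂ (y , refl) = inj₂ (kindSign-1+2y y ,
        subst (λ z → kindSign (blockKind z) ≡ + 1) (sym (ring c y)) (kindSign-2y (c - y)))
  where
  ring : ∀ c y → + 1 + + 2 * c - (+ 1 + + 2 * y) ≡ + 2 * (c - y)
  ring = solve-∀

kindSign-oddSum : ∀ e e′ c → e + e′ ≡ + 1 + + 2 * c →
                  OppositeSigns (kindSign (blockKind e)) (kindSign (blockKind e′))
kindSign-oddSum e e′ c e+e′≡ =
  subst (OppositeSigns (kindSign (blockKind e)) ∘ kindSign ∘ blockKind) (sym e′≡) (kindSign-complement e c)
  where
  ring : ∀ a b → b ≡ a + b - a
  ring = solve-∀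
  e′≡ : e′ ≡ + 1 + + 2 * c - e
  e′≡ = trans (ring e e′) (cong (_- e) e+e′≡)

-- Blocks of M_p and M_p*

diagShift : BlockKind → ℤ
diagShift diag     = + 0
diagShift odd+1    = + 4
diagShift odd-1    = - + 4
diagShift (pow+ x) = + (x ℕ.+ 4)
diagShift (pow- x) = - + (x ℕ.+ 4)

blockM-decomposition : ∀ K r c → blockM K r c ≡ kindSign K * M4 r c + diagShift K * I4 r c
blockM-decomposition diag     r c = ring (M4 r c) (I4 r c)
  where
  ring : ∀ m i → m ≡ + 1 * m + + 0 * i
  ring = solve-∀
blockM-decomposition odd+1    r c = ring (M4 r c) (I4 r c)
  where
  ring : ∀ m i → - m + + 4 * i ≡ - + 1 * m + + 4 * i
  ring = solve-∀
blockM-decomposition odd-1    r c = ring (M4 r c) (I4 r c)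
  where
  ring : ∀ m i → - m - + 4 * i ≡ - + 1 * m + - + 4 * i
  ring = solve-∀
blockM-decomposition (pow+ x) r c = ring (M4 r c) (I4 r c) (+ (x ℕ.+ 4))
  where
  ring : ∀ m i a → m + a * i ≡ + 1 * m + a * i
  ring = solve-∀
blockM-decomposition (pow- x) r c = ring (M4 r c) (I4 r c) (+ (x ℕ.+ 4))
  where
  ring : ∀ m i a → m - a * i ≡ + 1 * m + - a * i
  ring = solve-∀

blockM*-decomposition : ∀ K r c → blockM* K r c ≡ kindSign K * M4* r c - diagShift K * I4 r c
blockM*-decomposition diag     r c = ring (M4* r c) (I4 r c)
  where
  ring : ∀ m i → m ≡ + 1 * m - + 0 * i
  ring = solve-∀
blockM*-decomposition odd+1    r c = ring (M4* r c) (I4 r c)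
  where
  ring : ∀ m i → - m - + 4 * i ≡ - + 1 * m - + 4 * i
  ring = solve-∀
blockM*-decomposition odd-1    r c = ring (M4* r c) (I4 r c)
  where
  ring : ∀ m i → - m + + 4 * i ≡ - + 1 * m - - + 4 * i
  ring = solve-∀
blockM*-decomposition (pow+ x) r c = ring (M4* r c) (I4 r c) (+ (x ℕ.+ 4))
  where
  ring : ∀ m i a → m - a * i ≡ + 1 * m - a * i
  ring = solve-∀
blockM*-decomposition (pow- x) r c = ring (M4* r c) (I4 r c) (+ (x ℕ.+ 4))
  where
  ring : ∀ m i a → m + a * i ≡ + 1 * m - - a * i
  ring = solve-∀

M4-diagonal : ∀ r → M4 r r ≡ + 0
M4-diagonal 0 = refl
M4-diagonal 1 = refl
M4-diagonal 2 = refl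
M4-diagonal 3 = refl
M4-diagonal 4 = refl
M4-diagonal (suc (suc (suc (suc (suc _))))) = refl

M4*-diagonal : ∀ r → M4* r r ≡ + 0
M4*-diagonal 0 = refl
M4*-diagonal 1 = refl
M4*-diagonal 2 = refl
M4*-diagonal 3 = refl
M4*-diagonal 4 = refl
M4*-diagonal (suc (suc (suc (suc (suc _))))) = refl

I4-diagonal : ∀ r → I4 r r ≡ + 1
I4-diagonal r with r ≟ r
... | yes _   = refl
... | no r≢r = ⊥-elim (r≢r refl)

I4-offDiagonal : ∀ {r c} → r ≢ c → I4 r c ≡ + 0
I4-offDiagonal {r} {c} r≢c with r ≟ c
... | yes r≡c = ⊥-elim (r≢c r≡c)
... | no _    = refl

blockM-offDiagonal : ∀ K {r c} → r ≢ c → blockM K r c ≡ kindSign K * M4 r c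
blockM-offDiagonal K {r} {c} r≢c = begin
  blockM K r c                                ≡⟨ blockM-decomposition K r c ⟩
  kindSign K * M4 r c + diagShift K * I4 r c  ≡⟨ cong (_+_ (kindSign K * M4 r c)) (cong (diagShift K *_) (I4-offDiagonal r≢c)) ⟩
  kindSign K * M4 r c + diagShift K * + 0     ≡⟨ ring (kindSign K * M4 r c) (diagShift K) ⟩
  kindSign K * M4 r c                         ∎
  where
  open ≡-Reasoning
  ring : ∀ x a → x + a * + 0 ≡ x
  ring = solve-∀

blockM*-offDiagonal : ∀ K {r c} → r ≢ c → blockM* K r c ≡ kindSign K * M4* r c
blockM*-offDiagonal K {r} {c} r≢c = begin
  blockM* K r c                                ≡⟨ blockM*-decomposition K r c ⟩
  kindSign K * M4* r c - diagShift K * I4 r c  ≡⟨ cong (_-_ (kindSign K * M4* r c)) (cong (diagShift K *_) (I4-offDiagonal r≢c)) ⟩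
  kindSign K * M4* r c - diagShift K * + 0     ≡⟨ ring (kindSign K * M4* r c) (diagShift K) ⟩
  kindSign K * M4* r c                         ∎
  where
  open ≡-Reasoning
  ring : ∀ x a → x - a * + 0 ≡ x
  ring = solve-∀

blockM-diagonal : ∀ K r → blockM K r r ≡ diagShift K
blockM-diagonal K r = begin
  blockM K r r                                ≡⟨ blockM-decomposition K r r ⟩
  kindSign K * M4 r r + diagShift K * I4 r r
    ≡⟨ cong₂ (λ m i → kindSign K * m + diagShift K * i) (M4-diagonal r) (I4-diagonal r) ⟩
  kindSign K * + 0 + diagShift K * + 1        ≡⟨ ring (kindSign K) (diagShift K) ⟩
  diagShift K                                 ∎
  where
  open ≡-Reasoning
  ring : ∀ s a → s * + 0 + a * + 1 ≡ a
  ring = solve-∀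

blockM*-diagonal : ∀ K r → blockM* K r r ≡ - diagShift K
blockM*-diagonal K r = begin
  blockM* K r r                               ≡⟨ blockM*-decomposition K r r ⟩
  kindSign K * M4* r r - diagShift K * I4 r r
    ≡⟨ cong₂ (λ m i → kindSign K * m - diagShift K * i) (M4*-diagonal r) (I4-diagonal r) ⟩
  kindSign K * + 0 - diagShift K * + 1        ≡⟨ ring (kindSign K) (diagShift K) ⟩
  - diagShift K                               ∎
  where
  open ≡-Reasoning
  ring : ∀ s a → s * + 0 - a * + 1 ≡ - a
  ring = solve-∀

diagShift-opposite : ∀ K → diagShift (opposite K) ≡ - diagShift K
diagShift-opposite diag     = refl
diagShift-opposite odd+1    = refl
diagShift-opposite odd-1    = refl
diagShift-opposite (pow+ x) = refl
diagShift-opposite (pow- x) = sym (ℤ.neg-involutive (+ (x ℕ.+ 4)))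

blockM≡blockM*-offDiagonal : ∀ K K′ {r c r′ c′} → r ≢ c → r′ ≢ c′ → M4 r c ≡ - M4* r′ c′ →
                             OppositeSigns (kindSign K) (kindSign K′) → blockM K r c ≡ blockM* K′ r′ c′
blockM≡blockM*-offDiagonal K K′ {r} {c} {r′} {c′} r≢c r′≢c′ M4≡-M4* signs = begin
  blockM K r c              ≡⟨ blockM-offDiagonal K r≢c ⟩
  kindSign K * M4 r c       ≡⟨ cong (kindSign K *_) M4≡-M4* ⟩
  kindSign K * - M4* r′ c′  ≡⟨ OppositeSigns-flip (M4* r′ c′) signs ⟩
  kindSign K′ * M4* r′ c′   ≡⟨ blockM*-offDiagonal K′ r′≢c′ ⟨
  blockM* K′ r′ c′          ∎
  where open ≡-Reasoning

blockM≡-blockM*-diagonal : ∀ K r → blockM K r r ≡ - blockM* K r r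
blockM≡-blockM*-diagonal K r =
  trans (blockM-diagonal K r) (trans (sym (ℤ.neg-involutive (diagShift K))) (cong -_ (sym (blockM*-diagonal K r))))

blockM≡blockM*-opposite-diagonal : ∀ K r → blockM K r r ≡ blockM* (opposite K) r r
blockM≡blockM*-opposite-diagonal K r =
  trans (blockM-diagonal K r) (trans (sym (ℤ.neg-involutive (diagShift K)))
        (trans (cong -_ (sym (diagShift-opposite K))) (sym (blockM*-diagonal (opposite K) r))))

-- Paired block differences

-- The bound v + 4 ≤ n leaves room to add multiples of 2^(n−2) (Paired-shift).
data Paired (n : ℕ) (e e′ : ℤ) : Set where
  paired : ∀ v s w w′ → v ℕ.+ 4 ≤ n →
           e ≡ dyadic v s w → e′ ≡ dyadic v (Sign.opposite s) w′ → Paired n e e′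

Paired⇒opposite-kinds : ∀ {n e e′} → Paired n e e′ → blockKind e′ ≡ opposite (blockKind e)
Paired⇒opposite-kinds (paired v s w w′ _ refl refl) =
  trans (blockKind-dyadic v (Sign.opposite s) w′)
        (trans (sym (opposite-dyadicKind v s)) (cong opposite (sym (blockKind-dyadic v s w))))

-dyadic : ∀ v s w → - dyadic v s w ≡ dyadic v (Sign.opposite s) (- w)
-dyadic v Sign.+ w = ring (+ (2 ^ v)) w
  where
  ring : ∀ P w → - (P * (+ 1 + w * + 4)) ≡ P * (- + 1 + - w * + 4)
  ring = solve-∀
-dyadic v Sign.- w = ring (+ (2 ^ v)) w
  where
  ring : ∀ P w → - (P * (- + 1 + w * + 4)) ≡ P * (+ 1 + - w * + 4)
  ring = solve-∀

Paired-neg : ∀ {n e e′} → Paired n e e′ → Paired n (- e) (- e′)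
Paired-neg (paired v Sign.+ w w′ v+4≤n refl refl) =
  paired v Sign.- (- w) (- w′) v+4≤n (-dyadic v Sign.+ w) (-dyadic v Sign.- w′)
Paired-neg (paired v Sign.- w w′ v+4≤n refl refl) =
  paired v Sign.+ (- w) (- w′) v+4≤n (-dyadic v Sign.- w) (-dyadic v Sign.+ w′)

Paired-shift : ∀ {n e e′} c c′ → Paired n e e′ →
               Paired (suc n) (e + c * + (2 ^ (n ∸ 2))) (e′ + c′ * + (2 ^ (n ∸ 2)))
Paired-shift {n} c c′ (paired v s w w′ v+4≤n refl refl) =
  paired v s (w + c * Q) (w′ + c′ * Q) (ℕ.m≤n⇒m≤1+n v+4≤n) (shifted s w c) (shifted (Sign.opposite s) w′ c′)
  where
  t : ℕ
  t = (n ∸ 2) ∸ (v ℕ.+ 2)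
  Q : ℤ
  Q = + (2 ^ t)
  v+2≤n-2 : v ℕ.+ 2 ≤ n ∸ 2
  v+2≤n-2 = subst (_≤ n ∸ 2) (ℕ.+-∸-assoc v (s≤s (s≤s z≤n))) (ℕ.∸-monoˡ-≤ 2 v+4≤n)
  2^[n-2] : + (2 ^ (n ∸ 2)) ≡ + (2 ^ v) * (+ 4 * Q)
  2^[n-2] = begin
    + (2 ^ (n ∸ 2))                 ≡⟨ cong (λ m → + (2 ^ m)) (ℕ.m+[n∸m]≡n v+2≤n-2) ⟨
    + (2 ^ (v ℕ.+ 2 ℕ.+ t))         ≡⟨ cong +_ (ℕ.^-distribˡ-+-* 2 (v ℕ.+ 2) t) ⟩
    + (2 ^ (v ℕ.+ 2) ℕ.* 2 ^ t)     ≡⟨ cong (λ x → + (x ℕ.* 2 ^ t)) (ℕ.^-distribˡ-+-* 2 v 2) ⟩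
    + (2 ^ v ℕ.* 4 ℕ.* 2 ^ t)       ≡⟨ cong +_ (ℕ.*-assoc (2 ^ v) 4 (2 ^ t)) ⟩
    + (2 ^ v ℕ.* (4 ℕ.* 2 ^ t))     ≡⟨ trans (ℤ.pos-* (2 ^ v) _) (cong (+ (2 ^ v) *_) (ℤ.pos-* 4 (2 ^ t))) ⟩
    + (2 ^ v) * (+ 4 * Q)           ∎
    where open ≡-Reasoning
  shifted : ∀ s w c → dyadic v s w + c * + (2 ^ (n ∸ 2)) ≡ dyadic v s (w + c * Q)
  shifted s w c = trans (cong (λ x → dyadic v s w + c * x) 2^[n-2]) (ring (+ (2 ^ v)) (s ◃ 1) w c Q)
    where
    ring : ∀ P u w c Q → P * (u + w * + 4) + c * (P * (+ 4 * Q)) ≡ P * (u + (w + c * Q) * + 4)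
    ring = solve-∀

HalfApart : ℕ → ℤ → Set
HalfApart n e = 3 ≤ n × ∃ λ s → e ≡ (s ◃ 1) * + (2 ^ (n ∸ 3))

-- The shifts c and 1 + 2d − c have odd sum, which is what separates two equal differences
-- ±2^(n−3) into a Paired couple.
HalfApart-shift : ∀ {n e} c d → HalfApart n e →
  Paired (suc n) (e + c * + (2 ^ (n ∸ 2))) (e + (+ 1 + + 2 * d - c) * + (2 ^ (n ∸ 2)))
HalfApart-shift {suc (suc (suc m))} c d (s≤s (s≤s (s≤s _)) , s , refl) =
  subst (λ X → Paired (suc (suc (suc (suc m)))) ((s ◃ 1) * P + c * X) ((s ◃ 1) * P + (+ 1 + + 2 * d - c) * X))
        (sym (ℤ.pos-* 2 (2 ^ m))) (by-parity s (even⊎odd c))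
  where
  P : ℤ
  P = + (2 ^ m)
  m+4≤n : m ℕ.+ 4 ≤ suc (suc (suc (suc m)))
  m+4≤n = ℕ.≤-reflexive (ℕ.+-comm m 4)
  by-parity : ∀ s → (∃ λ a → c ≡ + 2 * a) ⊎ (∃ λ a → c ≡ + 1 + + 2 * a) →
    Paired (suc (suc (suc (suc m)))) ((s ◃ 1) * P + c * (+ 2 * P)) ((s ◃ 1) * P + (+ 1 + + 2 * d - c) * (+ 2 * P))
  by-parity Sign.+ (inj₁ (a , refl)) = paired m Sign.+ a (+ 1 + d - a) m+4≤n (ring₁ P a) (ring₂ P a d)
    where
    ring₁ : ∀ P a → + 1 * P + + 2 * a * (+ 2 * P) ≡ P * (+ 1 + a * + 4)
    ring₁ = solve-∀
    ring₂ : ∀ P a d → + 1 * P + (+ 1 + + 2 * d - + 2 * a) * (+ 2 * P) ≡ P * (- + 1 + (+ 1 + d - a) * + 4)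
    ring₂ = solve-∀
  by-parity Sign.+ (inj₂ (a , refl)) = paired m Sign.- (+ 1 + a) (d - a) m+4≤n (ring₁ P a) (ring₂ P a d)
    where
    ring₁ : ∀ P a → + 1 * P + (+ 1 + + 2 * a) * (+ 2 * P) ≡ P * (- + 1 + (+ 1 + a) * + 4)
    ring₁ = solve-∀
    ring₂ : ∀ P a d → + 1 * P + (+ 1 + + 2 * d - (+ 1 + + 2 * a)) * (+ 2 * P) ≡ P * (+ 1 + (d - a) * + 4)
    ring₂ = solve-∀
  by-parity Sign.- (inj₁ (a , refl)) = paired m Sign.- a (d - a) m+4≤n (ring₁ P a) (ring₂ P a d)
    where
    ring₁ : ∀ P a → - + 1 * P + + 2 * a * (+ 2 * P) ≡ P * (- + 1 + a * + 4)
    ring₁ = solve-∀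
    ring₂ : ∀ P a d → - + 1 * P + (+ 1 + + 2 * d - + 2 * a) * (+ 2 * P) ≡ P * (+ 1 + (d - a) * + 4)
    ring₂ = solve-∀
  by-parity Sign.- (inj₂ (a , refl)) = paired m Sign.+ a (d - a) m+4≤n (ring₁ P a) (ring₂ P a d)
    where
    ring₁ : ∀ P a → - + 1 * P + (+ 1 + + 2 * a) * (+ 2 * P) ≡ P * (+ 1 + a * + 4)
    ring₁ = solve-∀
    ring₂ : ∀ P a d → - + 1 * P + (+ 1 + + 2 * d - (+ 1 + + 2 * a)) * (+ 2 * P) ≡ P * (- + 1 + (d - a) * + 4)
    ring₂ = solve-∀

-- The permutations σ_{p,k}

blk-shift : ∀ {y} H → 1 ≤ y → blk (y ℕ.+ H ℕ.* 4) ≡ blk y ℕ.+ H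
blk-shift {y} H 1≤y = begin
  ((y ℕ.+ H ℕ.* 4) ∸ 1) ℕ./ 4 ℕ.+ 1        ≡⟨ cong (λ x → x ℕ./ 4 ℕ.+ 1) (ℕ.+-∸-comm (H ℕ.* 4) 1≤y) ⟩
  ((y ∸ 1) ℕ.+ H ℕ.* 4) ℕ./ 4 ℕ.+ 1        ≡⟨ cong (ℕ._+ 1) (ℕ.+-distrib-/-∣ʳ (y ∸ 1) (divides-refl H)) ⟩
  (y ∸ 1) ℕ./ 4 ℕ.+ H ℕ.* 4 ℕ./ 4 ℕ.+ 1    ≡⟨ cong (λ x → (y ∸ 1) ℕ./ 4 ℕ.+ x ℕ.+ 1) (ℕ.m*n/n≡m H 4) ⟩
  (y ∸ 1) ℕ./ 4 ℕ.+ H ℕ.+ 1                ≡⟨ ring ((y ∸ 1) ℕ./ 4) H ⟩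
  (y ∸ 1) ℕ./ 4 ℕ.+ 1 ℕ.+ H                ∎
  where
  open ≡-Reasoning
  ring : ∀ a b → a ℕ.+ b ℕ.+ 1 ≡ a ℕ.+ 1 ℕ.+ b
  ring = ℕ-Ring.solve-∀

pos-shift : ∀ {y} H → 1 ≤ y → pos (y ℕ.+ H ℕ.* 4) ≡ pos y
pos-shift {y} H 1≤y = cong (ℕ._+ 1) (begin
  ((y ℕ.+ H ℕ.* 4) ∸ 1) ℕ.% 4   ≡⟨ cong (ℕ._% 4) (ℕ.+-∸-comm (H ℕ.* 4) 1≤y) ⟩
  ((y ∸ 1) ℕ.+ H ℕ.* 4) ℕ.% 4   ≡⟨ ℕ.[m+kn]%n≡m%n (y ∸ 1) H 4 ⟩
  (y ∸ 1) ℕ.% 4                 ∎)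
  where open ≡-Reasoning

record Sigma4Facts (r c : ℕ) : Set where
  constructor sigma4-facts
  field
    1≤σ   : 1 ≤ sigma4 r c
    pos-σ : pos (sigma4 r c) ≡ sigma4 r c
    blk-σ : blk (sigma4 r c) ≡ 1
    σ≢r   : sigma4 r c ≢ r
    row   : M4 r c ≡ - M4* r (sigma4 r c)
    col   : M4 r c ≡ - M4* (sigma4 c r) c

sigma4-correct : ∀ {r c} → 1 ≤ r → r ≤ 4 → 1 ≤ c → c ≤ 4 → r ≢ c → Sigma4Facts r c
sigma4-correct {1} {1} _ _ _ _ r≢c = ⊥-elim (r≢c refl)
sigma4-correct {1} {2} _ _ _ _ _ = sigma4-facts (s≤s z≤n) refl refl (λ ()) refl refl
sigma4-correct {1} {3} _ _ _ _ _ = sigma4-facts (s≤s z≤n) refl refl (λ ()) refl refl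
sigma4-correct {1} {4} _ _ _ _ _ = sigma4-facts (s≤s z≤n) refl refl (λ ()) refl refl
sigma4-correct {2} {1} _ _ _ _ _ = sigma4-facts (s≤s z≤n) refl refl (λ ()) refl refl
sigma4-correct {2} {2} _ _ _ _ r≢c = ⊥-elim (r≢c refl)
sigma4-correct {2} {3} _ _ _ _ _ = sigma4-facts (s≤s z≤n) refl refl (λ ()) refl refl
sigma4-correct {2} {4} _ _ _ _ _ = sigma4-facts (s≤s z≤n) refl refl (λ ()) refl refl
sigma4-correct {3} {1} _ _ _ _ _ = sigma4-facts (s≤s z≤n) refl refl (λ ()) refl refl
sigma4-correct {3} {2} _ _ _ _ _ = sigma4-facts (s≤s z≤n) refl refl (λ ()) refl refl
sigma4-correct {3} {3} _ _ _ _ r≢c = ⊥-elim (r≢c refl)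
sigma4-correct {3} {4} _ _ _ _ _ = sigma4-facts (s≤s z≤n) refl refl (λ ()) refl refl
sigma4-correct {4} {1} _ _ _ _ _ = sigma4-facts (s≤s z≤n) refl refl (λ ()) refl refl
sigma4-correct {4} {2} _ _ _ _ _ = sigma4-facts (s≤s z≤n) refl refl (λ ()) refl refl
sigma4-correct {4} {3} _ _ _ _ _ = sigma4-facts (s≤s z≤n) refl refl (λ ()) refl refl
sigma4-correct {4} {4} _ _ _ _ r≢c = ⊥-elim (r≢c refl)
sigma4-correct {0} () _ _ _ _
sigma4-correct {suc (suc (suc (suc (suc _))))} _ (s≤s (s≤s (s≤s (s≤s ())))) _ _ _
sigma4-correct {_} {0} _ _ () _ _
sigma4-correct {_} {suc (suc (suc (suc (suc _))))} _ _ _ (s≤s (s≤s (s≤s (s≤s ())))) _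

pos-blk-small : ∀ {r} → 1 ≤ r → r ≤ 4 → pos r ≡ r × blk r ≡ 1
pos-blk-small {1} _ _ = refl , refl
pos-blk-small {2} _ _ = refl , refl
pos-blk-small {3} _ _ = refl , refl
pos-blk-small {4} _ _ = refl , refl
pos-blk-small {suc (suc (suc (suc (suc _))))} _ (s≤s (s≤s (s≤s (s≤s ()))))

half : ℕ → ℕ
half n = 2 ^ (n ∸ 1)

Antipodal : ℕ → ℕ → ℕ → Set
Antipodal n k i = i ≡ k ℕ.+ half n ⊎ k ≡ i ℕ.+ half n

blockDiff : ℕ → ℕ → ℤ
blockDiff k i = + blk i - + blk k

data Aligned (n k i s : ℕ) : Set where
  antipodal    : Antipodal n k i → s ≡ i → HalfApart n (blockDiff k i) → Aligned n k i s
  nonAntipodal : ¬ Antipodal n k i → Paired n (blockDiff k i) (blockDiff k s) → Aligned n k i s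

-- s stands for σ_{p,k}(i) with p = 2^n; there are 2^(n−2) blocks.
record SigmaSpec (n k i s : ℕ) : Set where
  field
    1≤s           : 1 ≤ s
    offsetsDiffer : pos i ≢ pos k → pos s ≡ sigma4 (pos k) (pos i) × blk s ℕ.+ blk i ≡ 2 ^ (n ∸ 2) ℕ.+ 1
    offsetsAgree  : pos i ≡ pos k → pos s ≡ pos i × Aligned n k i s

SigmaSpecAt : ℕ → Set
SigmaSpecAt n = ∀ {k i} → 1 ≤ k → k ≤ 2 ^ n → 1 ≤ i → i ≤ 2 ^ n → i ≢ k → SigmaSpec n k i (sigma n k i)

sigmaSpec-4 : SigmaSpecAt 2
sigmaSpec-4 {k} {i} 1≤k k≤4 1≤i i≤4 i≢k = record
  { 1≤s           = 1≤σ
  ; offsetsDiffer = λ _ → trans pos-σ (cong₂ sigma4 (sym pos-k) (sym pos-i)) , cong₂ ℕ._+_ blk-σ blk-i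
  ; offsetsAgree  = λ pos-i≡pos-k → ⊥-elim (i≢k (trans (sym pos-i) (trans pos-i≡pos-k pos-k)))
  }
  where
  open Sigma4Facts (sigma4-correct 1≤k k≤4 1≤i i≤4 (λ k≡i → i≢k (sym k≡i)))
  pos-k : pos k ≡ k
  pos-k = proj₁ (pos-blk-small 1≤k k≤4)
  pos-i : pos i ≡ i
  pos-i = proj₁ (pos-blk-small 1≤i i≤4)
  blk-i : blk i ≡ 1
  blk-i = proj₂ (pos-blk-small 1≤i i≤4)

Aligned-shift : ∀ {n k i s} c d → Aligned n k i s →
  Paired (suc n) (blockDiff k i + c * + (2 ^ (n ∸ 2))) (blockDiff k s + (+ 1 + + 2 * d - c) * + (2 ^ (n ∸ 2)))
Aligned-shift c d (antipodal _ refl apart) = HalfApart-shift c d apart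
Aligned-shift c d (nonAntipodal _ pairs)   = Paired-shift c (+ 1 + + 2 * d - c) pairs

module SigmaStep (m : ℕ) where
  n h H : ℕ
  n = suc (suc m)
  h = 2 ^ n
  H = 2 ^ m

  h≡H*4 : h ≡ H ℕ.* 4
  h≡H*4 = trans (sym (ℕ.*-assoc 2 2 H)) (ℕ.*-comm 4 H)

  pos-+h : ∀ {y} → 1 ≤ y → pos (y ℕ.+ h) ≡ pos y
  pos-+h {y} 1≤y = trans (cong (λ x → pos (y ℕ.+ x)) h≡H*4) (pos-shift H 1≤y)

  1≤+h : ∀ {y} → 1 ≤ y → 1 ≤ y ℕ.+ h
  1≤+h {y} 1≤y = ℕ.≤-trans 1≤y (ℕ.m≤m+n y h)

  lower≢upper : ∀ {x y} → 1 ≤ y → x ≤ h → x ≢ y ℕ.+ h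
  lower≢upper {x} {y} 1≤y x≤h x≡y+h = ℕ.<⇒≱ (ℕ.m<n+m h 1≤y) (subst (_≤ h) x≡y+h x≤h)

  data Half : ℕ → Set where
    lower : ∀ {x} → x ≤ h → Half x
    upper : ∀ {x} → 1 ≤ x → x ≤ h → Half (x ℕ.+ h)

  half? : ∀ {x} → x ≤ 2 ^ suc n → Half x
  half? {x} x≤2h with x ℕ.≤? h
  ... | yes x≤h = lower x≤h
  ... | no x≰h = subst Half (ℕ.m∸n+n≡m (ℕ.<⇒≤ h<x))
                   (upper (ℕ.m<n⇒0<n∸m h<x) (ℕ.m≤n+o⇒m∸n≤o x h x≤h+h))
    where
    h<x : h < x
    h<x = ℕ.≰⇒> x≰h
    x≤h+h : x ≤ h ℕ.+ h
    x≤h+h = subst (x ≤_) (cong (h ℕ.+_) (ℕ.+-identityʳ h)) x≤2h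

  upper≰h : ∀ {x} → 1 ≤ x → x ℕ.+ h ℕ.≰ h
  upper≰h 1≤x = ℕ.<⇒≱ (ℕ.m<n+m h 1≤x)

  sigma-lower-lower : ∀ {k i} → k ≤ h → i ≤ h → sigma (suc n) k i ≡ sigma n k i ℕ.+ h
  sigma-lower-lower {k} {i} k≤h i≤h with k ℕ.≤? h | i ℕ.≤? h
  ... | yes _    | yes _    = refl
  ... | no k≰h   | _        = contradiction k≤h k≰h
  ... | yes _    | no i≰h   = contradiction i≤h i≰h

  sigma-lower-antipode : ∀ {k} → k ≤ h → 1 ≤ k → sigma (suc n) k (k ℕ.+ h) ≡ k ℕ.+ h
  sigma-lower-antipode {k} k≤h 1≤k with k ℕ.≤? h | k ℕ.+ h ℕ.≤? h | k ℕ.+ h ≟ k ℕ.+ h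
  ... | yes _  | no _      | yes _ = refl
  ... | no k≰h | _         | _     = contradiction k≤h k≰h
  ... | yes _  | yes k+h≤h | _     = contradiction k+h≤h (upper≰h 1≤k)
  ... | yes _  | no _      | no k+h≢k+h = contradiction refl k+h≢k+h

  sigma-lower-upper : ∀ {k i} → k ≤ h → 1 ≤ i → i ≢ k → sigma (suc n) k (i ℕ.+ h) ≡ sigma n k i
  sigma-lower-upper {k} {i} k≤h 1≤i i≢k with k ℕ.≤? h | i ℕ.+ h ℕ.≤? h | i ℕ.+ h ≟ k ℕ.+ h
  ... | yes _  | no _      | no _  = cong (sigma n k) (ℕ.m+n∸n≡m i h)
  ... | no k≰h | _         | _     = contradiction k≤h k≰h
  ... | yes _  | yes i+h≤h | _     = contradiction i+h≤h (upper≰h 1≤i)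
  ... | yes _  | no _      | yes i+h≡k+h = contradiction (ℕ.+-cancelʳ-≡ h i k i+h≡k+h) i≢k

  sigma-upper-antipode : ∀ {i} → 1 ≤ i → i ≤ h → sigma (suc n) (i ℕ.+ h) i ≡ i
  sigma-upper-antipode {i} 1≤i i≤h with i ℕ.+ h ℕ.≤? h | i ℕ.≤? h | i ≟ (i ℕ.+ h) ∸ h
  ... | no _      | yes _  | yes _ = ℕ.m+n∸n≡m i h
  ... | yes i+h≤h | _      | _     = contradiction i+h≤h (upper≰h 1≤i)
  ... | no _      | no i≰h | _     = contradiction i≤h i≰h
  ... | no _      | yes _  | no i≢i = contradiction (sym (ℕ.m+n∸n≡m i h)) i≢i

  sigma-upper-lower : ∀ {k i} → 1 ≤ k → i ≤ h → i ≢ k → sigma (suc n) (k ℕ.+ h) i ≡ sigma n k i ℕ.+ h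
  sigma-upper-lower {k} {i} 1≤k i≤h i≢k with k ℕ.+ h ℕ.≤? h | i ℕ.≤? h | i ≟ (k ℕ.+ h) ∸ h
  ... | no _      | yes _  | no _  = cong (λ x → sigma n x i ℕ.+ h) (ℕ.m+n∸n≡m k h)
  ... | yes k+h≤h | _      | _     = contradiction k+h≤h (upper≰h 1≤k)
  ... | no _      | no i≰h | _     = contradiction i≤h i≰h
  ... | no _      | yes _  | yes i≡k = contradiction (trans i≡k (ℕ.m+n∸n≡m k h)) i≢k

  sigma-upper-upper : ∀ {k i} → 1 ≤ k → 1 ≤ i → sigma (suc n) (k ℕ.+ h) (i ℕ.+ h) ≡ sigma n k i
  sigma-upper-upper {k} {i} 1≤k 1≤i with k ℕ.+ h ℕ.≤? h | i ℕ.+ h ℕ.≤? h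
  ... | no _      | no _      = cong₂ (sigma n) (ℕ.m+n∸n≡m k h) (ℕ.m+n∸n≡m i h)
  ... | yes k+h≤h | _         = contradiction k+h≤h (upper≰h 1≤k)
  ... | no _      | yes i+h≤h = contradiction i+h≤h (upper≰h 1≤i)

  blk-+h : ∀ {y} → 1 ≤ y → blk (y ℕ.+ h) ≡ blk y ℕ.+ H
  blk-+h {y} 1≤y = trans (cong (λ x → blk (y ℕ.+ x)) h≡H*4) (blk-shift H 1≤y)

  +blk-+h : ∀ {y} → 1 ≤ y → + blk (y ℕ.+ h) ≡ + blk y + + H
  +blk-+h {y} 1≤y = trans (cong +_ (blk-+h 1≤y)) (ℤ.pos-+ (blk y) H)

  blockDiff-+h-right : ∀ k {i} → 1 ≤ i → blockDiff k (i ℕ.+ h) ≡ blockDiff k i + + 1 * + H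
  blockDiff-+h-right k {i} 1≤i = trans (cong (_- + blk k) (+blk-+h 1≤i)) (ring (+ blk i) (+ blk k) (+ H))
    where
    ring : ∀ a b H → a + H - b ≡ a - b + + 1 * H
    ring = solve-∀

  blockDiff-+h-left : ∀ {k} i → 1 ≤ k → blockDiff (k ℕ.+ h) i ≡ blockDiff k i + - + 1 * + H
  blockDiff-+h-left {k} i 1≤k = trans (cong (λ x → + blk i - x) (+blk-+h 1≤k)) (ring (+ blk i) (+ blk k) (+ H))
    where
    ring : ∀ a b H → a - (b + H) ≡ a - b + - + 1 * H
    ring = solve-∀

  blockDiff-+h-both : ∀ {k i} → 1 ≤ k → 1 ≤ i → blockDiff (k ℕ.+ h) (i ℕ.+ h) ≡ blockDiff k i + + 0 * + H
  blockDiff-+h-both {k} {i} 1≤k 1≤i =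
    trans (cong₂ _-_ (+blk-+h 1≤i) (+blk-+h 1≤k)) (ring (+ blk i) (+ blk k) (+ H))
    where
    ring : ∀ a b H → a + H - (b + H) ≡ a - b + + 0 * H
    ring = solve-∀

  blockDiff-unshifted : ∀ k i → blockDiff k i ≡ blockDiff k i + + 0 * + H
  blockDiff-unshifted k i = ring (blockDiff k i) (+ H)
    where
    ring : ∀ d H → d ≡ d + + 0 * H
    ring = solve-∀

  sum-+H : ∀ a b → a ℕ.+ b ≡ H ℕ.+ 1 → a ℕ.+ b ℕ.+ H ≡ 2 ^ suc m ℕ.+ 1
  sum-+H a b a+b≡ = trans (cong (ℕ._+ H) a+b≡) (ring H)
    where
    ring : ∀ H → H ℕ.+ 1 ℕ.+ H ≡ 2 ℕ.* H ℕ.+ 1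
    ring = ℕ-Ring.solve-∀

  sum-+H-left : ∀ a b → a ℕ.+ b ≡ H ℕ.+ 1 → a ℕ.+ H ℕ.+ b ≡ 2 ^ suc m ℕ.+ 1
  sum-+H-left a b a+b≡ = trans (ring a b H) (sum-+H a b a+b≡)
    where
    ring : ∀ a b H → a ℕ.+ H ℕ.+ b ≡ a ℕ.+ b ℕ.+ H
    ring = ℕ-Ring.solve-∀

  sum-+H-right : ∀ a b → a ℕ.+ b ≡ H ℕ.+ 1 → a ℕ.+ (b ℕ.+ H) ≡ 2 ^ suc m ℕ.+ 1
  sum-+H-right a b a+b≡ = trans (sym (ℕ.+-assoc a b H)) (sum-+H a b a+b≡)

  spec-lower-lower : ∀ {k i s} → 1 ≤ k → k ≤ h → 1 ≤ i → i ≤ h →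
                     SigmaSpec n k i s → SigmaSpec (suc n) k i (s ℕ.+ h)
  spec-lower-lower {k} {i} {s} 1≤k k≤h 1≤i i≤h S = record
    { 1≤s           = 1≤+h 1≤s
    ; offsetsDiffer = map (trans (pos-+h 1≤s))
                          (λ sum → trans (cong (ℕ._+ blk i) (blk-+h 1≤s)) (sum-+H-left (blk s) (blk i) sum))
                      ∘ offsetsDiffer
    ; offsetsAgree  = map (trans (pos-+h 1≤s))
                          (λ A → nonAntipodal [ lower≢upper 1≤k i≤h , lower≢upper 1≤i k≤h ]
                                   (subst₂ (Paired (suc n)) (sym (blockDiff-unshifted k i)) (sym (blockDiff-+h-right k 1≤s))
                                           (Aligned-shift (+ 0) (+ 0) A)))
                      ∘ offsetsAgree
    }
    where open SigmaSpec S

  spec-lower-upper : ∀ {k i s} → k ≤ h → 1 ≤ i → i ≢ k →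
                     SigmaSpec n k i s → SigmaSpec (suc n) k (i ℕ.+ h) s
  spec-lower-upper {k} {i} {s} k≤h 1≤i i≢k S = record
    { 1≤s           = 1≤s
    ; offsetsDiffer = map (λ pos-s → trans pos-s (cong (sigma4 (pos k)) (sym (pos-+h 1≤i))))
                          (λ sum → trans (cong (blk s ℕ.+_) (blk-+h 1≤i)) (sum-+H-right (blk s) (blk i) sum))
                      ∘ offsetsDiffer ∘ (_∘ trans (pos-+h 1≤i))
    ; offsetsAgree  = map (λ pos-s → trans pos-s (sym (pos-+h 1≤i)))
                          (λ A → nonAntipodal [ i≢k ∘ ℕ.+-cancelʳ-≡ h i k , lower≢upper (1≤+h 1≤i) k≤h ]
                                   (subst₂ (Paired (suc n)) (sym (blockDiff-+h-right k 1≤i)) (sym (blockDiff-unshifted k s))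
                                           (Aligned-shift (+ 1) (+ 0) A)))
                      ∘ offsetsAgree ∘ trans (sym (pos-+h 1≤i))
    }
    where open SigmaSpec S

  spec-upper-lower : ∀ {k i s} → 1 ≤ k → i ≤ h → i ≢ k →
                     SigmaSpec n k i s → SigmaSpec (suc n) (k ℕ.+ h) i (s ℕ.+ h)
  spec-upper-lower {k} {i} {s} 1≤k i≤h i≢k S = record
    { 1≤s           = 1≤+h 1≤s
    ; offsetsDiffer = map (λ pos-s → trans (pos-+h 1≤s) (trans pos-s (cong (λ x → sigma4 x (pos i)) (sym (pos-+h 1≤k)))))
                          (λ sum → trans (cong (ℕ._+ blk i) (blk-+h 1≤s)) (sum-+H-left (blk s) (blk i) sum))
                      ∘ offsetsDiffer ∘ (_∘ λ pos-i≡pos-k → trans pos-i≡pos-k (sym (pos-+h 1≤k)))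
    ; offsetsAgree  = map (trans (pos-+h 1≤s))
                          (λ A → nonAntipodal [ lower≢upper (1≤+h 1≤k) i≤h , i≢k ∘ sym ∘ ℕ.+-cancelʳ-≡ h k i ]
                                   (subst₂ (Paired (suc n)) (sym (blockDiff-+h-left i 1≤k)) (sym (blockDiff-+h-both 1≤k 1≤s))
                                           (Aligned-shift (- + 1) (- + 1) A)))
                      ∘ offsetsAgree ∘ (λ pos-i≡pos-k+h → trans pos-i≡pos-k+h (pos-+h 1≤k))
    }
    where open SigmaSpec S

  spec-upper-upper : ∀ {k i s} → 1 ≤ k → k ≤ h → 1 ≤ i → i ≤ h →
                     SigmaSpec n k i s → SigmaSpec (suc n) (k ℕ.+ h) (i ℕ.+ h) s
  spec-upper-upper {k} {i} {s} 1≤k k≤h 1≤i i≤h S = record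
    { 1≤s           = 1≤s
    ; offsetsDiffer = map (λ pos-s → trans pos-s (sym (cong₂ sigma4 (pos-+h 1≤k) (pos-+h 1≤i))))
                          (λ sum → trans (cong (blk s ℕ.+_) (blk-+h 1≤i)) (sum-+H-right (blk s) (blk i) sum))
                      ∘ offsetsDiffer ∘ (_∘ shifted-offsets)
    ; offsetsAgree  = map (λ pos-s → trans pos-s (sym (pos-+h 1≤i)))
                          (λ A → nonAntipodal [ lower≢upper 1≤k i≤h ∘ ℕ.+-cancelʳ-≡ h i (k ℕ.+ h)
                                              , lower≢upper 1≤i k≤h ∘ ℕ.+-cancelʳ-≡ h k (i ℕ.+ h) ]
                                   (subst₂ (Paired (suc n)) (sym (blockDiff-+h-both 1≤k 1≤i)) (sym (blockDiff-+h-left s 1≤k))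
                                           (Aligned-shift (+ 0) (- + 1) A)))
                      ∘ offsetsAgree ∘ unshifted-offsets
    }
    where
    open SigmaSpec S
    shifted-offsets : pos i ≡ pos k → pos (i ℕ.+ h) ≡ pos (k ℕ.+ h)
    shifted-offsets pos-i≡pos-k = trans (pos-+h 1≤i) (trans pos-i≡pos-k (sym (pos-+h 1≤k)))
    unshifted-offsets : pos (i ℕ.+ h) ≡ pos (k ℕ.+ h) → pos i ≡ pos k
    unshifted-offsets pos-i+h≡pos-k+h = trans (sym (pos-+h 1≤i)) (trans pos-i+h≡pos-k+h (pos-+h 1≤k))

  spec-lower-antipode : ∀ {k} → 1 ≤ k → SigmaSpec (suc n) k (k ℕ.+ h) (k ℕ.+ h)
  spec-lower-antipode {k} 1≤k = record
    { 1≤s           = 1≤+h 1≤k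
    ; offsetsDiffer = λ pos≢ → contradiction (pos-+h 1≤k) pos≢
    ; offsetsAgree  = λ _ → refl , antipodal (inj₁ refl) refl (s≤s (s≤s (s≤s z≤n)) , Sign.+ , blocks-apart)
    }
    where
    blocks-apart : blockDiff k (k ℕ.+ h) ≡ + 1 * + H
    blocks-apart = trans (cong (_- + blk k) (+blk-+h 1≤k)) (ring (+ blk k) (+ H))
      where
      ring : ∀ b H → b + H - b ≡ + 1 * H
      ring = solve-∀

  spec-upper-antipode : ∀ {i} → 1 ≤ i → SigmaSpec (suc n) (i ℕ.+ h) i i
  spec-upper-antipode {i} 1≤i = record
    { 1≤s           = 1≤i
    ; offsetsDiffer = λ pos≢ → contradiction (sym (pos-+h 1≤i)) pos≢
    ; offsetsAgree  = λ _ → refl , antipodal (inj₂ refl) refl (s≤s (s≤s (s≤s z≤n)) , Sign.- , blocks-apart)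
    }
    where
    blocks-apart : blockDiff (i ℕ.+ h) i ≡ - + 1 * + H
    blocks-apart = trans (cong (λ x → + blk i - x) (+blk-+h 1≤i)) (ring (+ blk i) (+ H))
      where
      ring : ∀ b H → b - (b + H) ≡ - + 1 * H
      ring = solve-∀

  step : SigmaSpecAt n → SigmaSpecAt (suc n)
  step IH {k} {i} 1≤k k≤2h 1≤i i≤2h i≢k with half? k≤2h | half? i≤2h
  ... | lower k≤h | lower i≤h =
    subst (SigmaSpec (suc n) k i) (sym (sigma-lower-lower k≤h i≤h))
          (spec-lower-lower 1≤k k≤h 1≤i i≤h (IH 1≤k k≤h 1≤i i≤h i≢k))
  ... | lower k≤h | upper {i₀} 1≤i₀ i₀≤h with i₀ ≟ k
  ...   | yes refl  = subst (SigmaSpec (suc n) k i) (sym (sigma-lower-antipode k≤h 1≤k)) (spec-lower-antipode 1≤k)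
  ...   | no i₀≢k   = subst (SigmaSpec (suc n) k i) (sym (sigma-lower-upper k≤h 1≤i₀ i₀≢k))
                            (spec-lower-upper k≤h 1≤i₀ i₀≢k (IH 1≤k k≤h 1≤i₀ i₀≤h i₀≢k))
  step IH {k} {i} 1≤k k≤2h 1≤i i≤2h i≢k | upper {k₀} 1≤k₀ k₀≤h | lower i≤h with i ≟ k₀
  ...   | yes refl  = subst (SigmaSpec (suc n) k i) (sym (sigma-upper-antipode 1≤i i≤h)) (spec-upper-antipode 1≤i)
  ...   | no i≢k₀   = subst (SigmaSpec (suc n) k i) (sym (sigma-upper-lower 1≤k₀ i≤h i≢k₀))
                            (spec-upper-lower 1≤k₀ i≤h i≢k₀ (IH 1≤k₀ k₀≤h 1≤i i≤h i≢k₀))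
  step IH {k} {i} 1≤k k≤2h 1≤i i≤2h i≢k | upper {k₀} 1≤k₀ k₀≤h | upper {i₀} 1≤i₀ i₀≤h =
    subst (SigmaSpec (suc n) k i) (sym (sigma-upper-upper 1≤k₀ 1≤i₀))
          (spec-upper-upper 1≤k₀ k₀≤h 1≤i₀ i₀≤h (IH 1≤k₀ k₀≤h 1≤i₀ i₀≤h (i≢k ∘ cong (ℕ._+ h))))

sigmaSpec : ∀ m → SigmaSpecAt (suc (suc m))
sigmaSpec zero    = sigmaSpec-4
sigmaSpec (suc m) = SigmaStep.step m (sigmaSpec m)

-- Entries of M_p and M_p*

Mp≡-Mp*-equalOffsets : ∀ n i j → pos j ≡ pos i → Mp n i j ≡ - Mp* n i j
Mp≡-Mp*-equalOffsets n i j pos-j≡pos-i rewrite pos-j≡pos-i = blockM≡-blockM*-diagonal (blockKind (blockDiff i j)) (pos i)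

Mp≡Mp*-paired : ∀ n i j r c {n′} → pos j ≡ pos i → pos r ≡ pos i → pos c ≡ pos i →
                Paired n′ (blockDiff i j) (blockDiff r c) → Mp n i j ≡ Mp* n r c
Mp≡Mp*-paired n i j r c pos-j pos-r pos-c pairs rewrite pos-j | pos-r | pos-c | Paired⇒opposite-kinds pairs =
  blockM≡blockM*-opposite-diagonal (blockKind (blockDiff i j)) (pos i)

signOf : ℕ → ℕ → ℕ → ℤ
signOf n i j = if ⌊ ∣ j - i ∣ ≟ half n ⌋ then - + 1 else + 1

Antipodal⇒distance : ∀ {n i j} → Antipodal n i j → ∣ j - i ∣ ≡ half n
Antipodal⇒distance {n} {i} (inj₁ refl) = trans (ℕ.∣-∣-comm (i ℕ.+ half n) i) (ℕ.∣m-m+n∣≡n i (half n))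
Antipodal⇒distance {n} {j = j} (inj₂ refl) = ℕ.∣m-m+n∣≡n j (half n)

distance⇒Antipodal : ∀ {n i j} → ∣ j - i ∣ ≡ half n → Antipodal n i j
distance⇒Antipodal {n} {i} {j} ∣j-i∣≡ with ℕ.≤-total i j
... | inj₁ i≤j =
  inj₁ (trans (sym (ℕ.m+[n∸m]≡n i≤j)) (cong (i ℕ.+_) (trans (sym (ℕ.m≤n⇒∣n-m∣≡n∸m i≤j)) ∣j-i∣≡)))
... | inj₂ j≤i =
  inj₂ (trans (sym (ℕ.m+[n∸m]≡n j≤i)) (cong (j ℕ.+_) (trans (sym (ℕ.m≤n⇒∣m-n∣≡n∸m j≤i)) ∣j-i∣≡)))

signOf-antipodal : ∀ {n i j} → Antipodal n i j → signOf n i j ≡ - + 1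
signOf-antipodal {n} {i} {j} A with ∣ j - i ∣ ≟ half n
... | yes _            = refl
... | no ∣j-i∣≢half = contradiction (Antipodal⇒distance {n} A) ∣j-i∣≢half

signOf-nonAntipodal : ∀ {n i j} → ¬ Antipodal n i j → signOf n i j ≡ + 1
signOf-nonAntipodal {n} {i} {j} ¬A with ∣ j - i ∣ ≟ half n
... | yes ∣j-i∣≡half = contradiction (distance⇒Antipodal {n} ∣j-i∣≡half) ¬A
... | no _             = refl

Antipodal-sym : ∀ {n i j} → Antipodal n i j → Antipodal n j i
Antipodal-sym = swap

Antipodal⇒equalOffsets : ∀ m {i j} → 1 ≤ i → 1 ≤ j → Antipodal (3 ℕ.+ m) i j → pos j ≡ pos i
Antipodal⇒equalOffsets m 1≤i _ (inj₁ refl) = SigmaStep.pos-+h m 1≤i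
Antipodal⇒equalOffsets m _ 1≤j (inj₂ refl) = sym (SigmaStep.pos-+h m 1≤j)

pos-sum : ∀ m a b → a ℕ.+ b ≡ 2 ^ suc m ℕ.+ 1 → + a + + b ≡ + 2 * + (2 ^ m) + + 1
pos-sum m a b a+b≡ = begin
  + a + + b                   ≡⟨ ℤ.pos-+ a b ⟨
  + (a ℕ.+ b)                 ≡⟨ cong +_ a+b≡ ⟩
  + (2 ℕ.* 2 ^ m ℕ.+ 1)       ≡⟨ ℤ.pos-+ (2 ℕ.* 2 ^ m) 1 ⟩
  + (2 ℕ.* 2 ^ m) + + 1       ≡⟨ cong (_+ + 1) (ℤ.pos-* 2 (2 ^ m)) ⟩
  + 2 * + (2 ^ m) + + 1       ∎
  where open ≡-Reasoning

blockDiff-oddSum-row : ∀ m {i j s} → blk s ℕ.+ blk j ≡ 2 ^ suc m ℕ.+ 1 →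
                       blockDiff i j + blockDiff i s ≡ + 1 + + 2 * (+ (2 ^ m) - + blk i)
blockDiff-oddSum-row m {i} {j} {s} sum =
  trans (ring₁ (+ blk i) (+ blk j) (+ blk s))
        (trans (cong (_- + 2 * + blk i) (pos-sum m (blk s) (blk j) sum)) (ring₂ (+ blk i) (+ (2 ^ m))))
  where
  ring₁ : ∀ i j s → (j - i) + (s - i) ≡ (s + j) - + 2 * i
  ring₁ = solve-∀
  ring₂ : ∀ i P → + 2 * P + + 1 - + 2 * i ≡ + 1 + + 2 * (P - i)
  ring₂ = solve-∀

blockDiff-oddSum-column : ∀ m {i j s} → blk s ℕ.+ blk i ≡ 2 ^ suc m ℕ.+ 1 →
                          blockDiff i j + blockDiff s j ≡ + 1 + + 2 * (+ blk j - + (2 ^ m) - + 1)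
blockDiff-oddSum-column m {i} {j} {s} sum =
  trans (ring₁ (+ blk i) (+ blk j) (+ blk s))
        (trans (cong (λ x → + 2 * + blk j - x) (pos-sum m (blk s) (blk i) sum)) (ring₂ (+ blk j) (+ (2 ^ m))))
  where
  ring₁ : ∀ i j s → (j - i) + (j - s) ≡ + 2 * j - (s + i)
  ring₁ = solve-∀
  ring₂ : ∀ j P → + 2 * j - (+ 2 * P + + 1) ≡ + 1 + + 2 * (j - P - + 1)
  ring₂ = solve-∀

1≤pos : ∀ i → 1 ≤ pos i
1≤pos i = ℕ.m≤n+m 1 ((i ∸ 1) ℕ.% 4)

pos≤4 : ∀ i → pos i ≤ 4
pos≤4 i = subst (_≤ 4) (ℕ.+-comm 1 ((i ∸ 1) ℕ.% 4)) (ℕ.m%n<n (i ∸ 1) 4)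

sigma4-correct-pos : ∀ i j → pos i ≢ pos j → Sigma4Facts (pos i) (pos j)
sigma4-correct-pos i j = sigma4-correct (1≤pos i) (pos≤4 i) (1≤pos j) (pos≤4 j)

≡+1* : ∀ {s a b} → s ≡ + 1 → a ≡ b → a ≡ s * b
≡+1* refl a≡b = trans a≡b (sym (ℤ.*-identityˡ _))

≡-1* : ∀ {s a b} → s ≡ - + 1 → a ≡ - b → a ≡ s * b
≡-1* refl a≡-b = trans a≡-b (sym (ℤ.-1*i≡-i _))

-blockDiff : ∀ k i → - blockDiff k i ≡ blockDiff i k
-blockDiff k i = ring (+ blk i) (+ blk k)
  where
  ring : ∀ a b → - (a - b) ≡ b - a
  ring = solve-∀

Mp-row : ∀ m {i j} → 1 ≤ i → i ≤ 2 ^ (3 ℕ.+ m) → 1 ≤ j → j ≤ 2 ^ (3 ℕ.+ m) → i ≢ j →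
         Mp (3 ℕ.+ m) i j ≡ signOf (3 ℕ.+ m) i j * Mp* (3 ℕ.+ m) i (sigma (3 ℕ.+ m) i j)
Mp-row m {i} {j} 1≤i i≤p 1≤j j≤p i≢j = by-offsets (pos j ≟ pos i)
  where
  n σ : ℕ
  n = 3 ℕ.+ m
  σ = sigma n i j
  open SigmaSpec (sigmaSpec (suc m) 1≤i i≤p 1≤j j≤p (i≢j ∘ sym))
  by-offsets : Dec (pos j ≡ pos i) → Mp n i j ≡ signOf n i j * Mp* n i σ
  by-offsets (no pos-j≢pos-i) with offsetsDiffer pos-j≢pos-i
  ... | pos-σ≡ , sum =
    ≡+1* (signOf-nonAntipodal {n} (pos-j≢pos-i ∘ Antipodal⇒equalOffsets m 1≤i 1≤j))
         (blockM≡blockM*-offDiagonal (blockKind (blockDiff i j)) (blockKind (blockDiff i σ))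
            (pos-j≢pos-i ∘ sym) (λ pos-i≡pos-σ → σ≢r (sym (trans pos-i≡pos-σ pos-σ≡)))
            (trans row (cong (λ x → - M4* (pos i) x) (sym pos-σ≡)))
            (kindSign-oddSum (blockDiff i j) (blockDiff i σ) (+ (2 ^ m) - + blk i) (blockDiff-oddSum-row m {i} {j} {σ} sum)))
    where open Sigma4Facts (sigma4-correct-pos i j (pos-j≢pos-i ∘ sym)) using (σ≢r; row)
  by-offsets (yes pos-j≡pos-i) with offsetsAgree pos-j≡pos-i
  ... | _ , antipodal A σ≡j _ =
    ≡-1* (signOf-antipodal {n} A) (trans (Mp≡-Mp*-equalOffsets n i j pos-j≡pos-i) (cong (λ x → - Mp* n i x) (sym σ≡j)))
  ... | pos-σ≡pos-j , nonAntipodal ¬A pairs =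
    ≡+1* (signOf-nonAntipodal {n} ¬A) (Mp≡Mp*-paired n i j i σ pos-j≡pos-i refl (trans pos-σ≡pos-j pos-j≡pos-i) pairs)

Mp-column : ∀ m {i j} → 1 ≤ i → i ≤ 2 ^ (3 ℕ.+ m) → 1 ≤ j → j ≤ 2 ^ (3 ℕ.+ m) → i ≢ j →
            Mp (3 ℕ.+ m) i j ≡ signOf (3 ℕ.+ m) i j * Mp* (3 ℕ.+ m) (sigma (3 ℕ.+ m) j i) j
Mp-column m {i} {j} 1≤i i≤p 1≤j j≤p i≢j = by-offsets (pos i ≟ pos j)
  where
  n σ : ℕ
  n = 3 ℕ.+ m
  σ = sigma n j i
  open SigmaSpec (sigmaSpec (suc m) 1≤j j≤p 1≤i i≤p i≢j)
  by-offsets : Dec (pos i ≡ pos j) → Mp n i j ≡ signOf n i j * Mp* n σ j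
  by-offsets (no pos-i≢pos-j) with offsetsDiffer pos-i≢pos-j
  ... | pos-σ≡ , sum =
    ≡+1* (signOf-nonAntipodal {n} (pos-i≢pos-j ∘ sym ∘ Antipodal⇒equalOffsets m 1≤i 1≤j))
         (blockM≡blockM*-offDiagonal (blockKind (blockDiff i j)) (blockKind (blockDiff σ j))
            pos-i≢pos-j (λ pos-σ≡pos-j → σ≢r (trans (sym pos-σ≡) pos-σ≡pos-j))
            (trans col (cong (λ x → - M4* x (pos j)) (sym pos-σ≡)))
            (kindSign-oddSum (blockDiff i j) (blockDiff σ j) (+ blk j - + (2 ^ m) - + 1)
                             (blockDiff-oddSum-column m {i} {j} {σ} sum)))
    where
    open Sigma4Facts (sigma4-correct-pos i j pos-i≢pos-j) using (col)
    open Sigma4Facts (sigma4-correct-pos j i (pos-i≢pos-j ∘ sym)) using (σ≢r)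
  by-offsets (yes pos-i≡pos-j) with offsetsAgree pos-i≡pos-j
  ... | _ , antipodal A σ≡i _ =
    ≡-1* (signOf-antipodal {n} (Antipodal-sym {n} A))
         (trans (Mp≡-Mp*-equalOffsets n i j (sym pos-i≡pos-j)) (cong (λ x → - Mp* n x j) (sym σ≡i)))
  ... | pos-σ≡pos-i , nonAntipodal ¬A pairs =
    ≡+1* (signOf-nonAntipodal {n} (¬A ∘ Antipodal-sym {n}))
         (Mp≡Mp*-paired n i j σ j (sym pos-i≡pos-j) pos-σ≡pos-i (sym pos-i≡pos-j)
            (subst₂ (Paired n) (-blockDiff j i) (-blockDiff j σ) (Paired-neg pairs)))

lemma3 : ((i j : ℕ) → 1 ≤ i → i ≤ 4 → 1 ≤ j → j ≤ 4 → i ≢ j →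
           (M4 i j ≡ - M4* i (sigma 2 i j)) × (M4 i j ≡ - M4* (sigma 2 j i) j))
         × ((n : ℕ) → 3 ≤ n → (i j : ℕ) → 1 ≤ i → i ≤ 2 ^ n → 1 ≤ j → j ≤ 2 ^ n → i ≢ j →
           (Mp n i j ≡ (if ⌊ ∣ j - i ∣ ≟ 2 ^ (n ∸ 1) ⌋ then - (+ 1) else + 1) * Mp* n i (sigma n i j))
           × (Mp n i j ≡ (if ⌊ ∣ j - i ∣ ≟ 2 ^ (n ∸ 1) ⌋ then - (+ 1) else + 1) * Mp* n (sigma n j i) j))
lemma3 = part-a , part-b
  where
  part-a : (i j : ℕ) → 1 ≤ i → i ≤ 4 → 1 ≤ j → j ≤ 4 → i ≢ j →
           (M4 i j ≡ - M4* i (sigma 2 i j)) × (M4 i j ≡ - M4* (sigma 2 j i) j)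
  part-a i j 1≤i i≤4 1≤j j≤4 i≢j = row , col
    where open Sigma4Facts (sigma4-correct 1≤i i≤4 1≤j j≤4 i≢j)
  part-b : (n : ℕ) → 3 ≤ n → (i j : ℕ) → 1 ≤ i → i ≤ 2 ^ n → 1 ≤ j → j ≤ 2 ^ n → i ≢ j →
           (Mp n i j ≡ signOf n i j * Mp* n i (sigma n i j)) × (Mp n i j ≡ signOf n i j * Mp* n (sigma n j i) j)
  part-b (suc (suc (suc m))) (s≤s (s≤s (s≤s _))) i j 1≤i i≤p 1≤j j≤p i≢j =
    Mp-row m 1≤i i≤p 1≤j j≤p i≢j , Mp-column m 1≤i i≤p 1≤j j≤p i≢j
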